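{- Let $a_1,a_2,a_3,a_4$ be positive integers with $(a_1,a_2,a_3)=1$. Let $p_{1,2},p_{1,3},p_{1,4},p_{2,3},p_{2,4},p_{3,4}$ be pairwise distinct primes such that $p_{1,4}\nmid a_1$, $p_{2,4}\nmid a_2$, $p_{3,4}\nmid a_3$, $p_{1,2}\nmid(a_1,a_2)$, $p_{1,3}\nmid(a_1,a_3)$, $p_{2,3}\nmid(a_2,a_3)$. Then every positive integer \[ n\ge a_3 p_{1,2}^2 p_{1,4}^2 p_{2,4}^2 + a_4 p_{1,2}^2 p_{1,3}^2 p_{2,3}^2 + \tfrac{a_1a_2}{(a_1,a_2)} p_{1,3}^2 p_{1,4}^2 p_{2,3}^2 p_{2,4}^2 p_{3,4}^2 + 2 \tfrac{a_1 a_3}{(a_1,a_3)} p_{1,2}^2 p_{1,4}^2 p_{2,3}^2 p_{2,4}^2 p_{3,4}^2 + 2 \tfrac{a_2 a_3}{(a_2,a_3)} p_{1,2}^2 p_{1,3}^2 p_{1,4}^2 p_{2,4}^2 p_{3,4}^2 \] can be written as $n=a_1\mu_1+a_2\mu_2+a_3\mu_3+a_4\mu_4$ with positive integers $\mu_1,\ldots,\mu_4$ such that $(\mu_1,\mu_2,\mu_3,\mu_4)$ is squarefree, but for all $i,j\in\{1,2,3,4\}$ the number $(\mu_i,\mu_j)$ is not squarefree.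
   Context: $(b_1,\ldots,b_k)$ denotes the greatest common divisor. -}

module Defs where

open import Data.Nat using (ℕ; _*_; _+_)
open import Data.Nat.Divisibility using (_∣_)
open import Data.Nat.GCD using (gcd)
open import Data.Fin using (Fin; zero; suc)
open import Relation.Binary.PropositionalEquality using (_≡_)

SquareFree : ℕ → Set
SquareFree n = ∀ d → d * d ∣ n → d ≡ 1

gcd4 : ℕ → ℕ → ℕ → ℕ → ℕ
gcd4 a b c d = gcd (gcd (gcd a b) c) d

gcd3 : ℕ → ℕ → ℕ → ℕ
gcd3 a b c = gcd (gcd a b) c

idx4 : ℕ → ℕ → ℕ → ℕ → Fin 4 → ℕ
idx4 a b c d zero = a
idx4 a b c d (suc zero) = b
idx4 a b c d (suc (suc zero)) = c
idx4 a b c d (suc (suc (suc zero))) = d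

sq : ℕ → ℕ
sq x = x * x

-- Put μᵢ = Aᵢ Xᵢ (i ≤ 3) and μ₄ = A₄, where Aᵢ is the product of the p_jk² with i ∉ {j, k}.
-- Any μᵢ, μⱼ then share the square of the prime of a pair disjoint from {i, j}, and a prime
-- square dividing all four μ's is p₁₂², p₁₃² or p₂₃². So it suffices to write
-- n - a₄ A₄ = b₁ X₁ + b₂ X₂ + b₃ X₃ (bᵢ = aᵢ Aᵢ) with positive Xᵢ such that p_ij² never divides
-- both Xᵢ and Xⱼ. No prime divides b₁, b₂ and b₃, so a linear congruence modulo b₃ yields a
-- representation with X₃ large. Then, pair by pair, a common multiple M_ij = bᵢ tᵢ = bⱼ tⱼ built
-- from lcm(aᵢ, aⱼ) is moved from Xⱼ to Xᵢ if needed: p_ij does not divide both tᵢ and tⱼ, so one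
-- of the two coordinates stops being divisible by p_ij².

module Submission where

open import Defs
open import Data.Nat using (ℕ; _*_; _+_; _≤_; _<_)
open import Data.Nat.Divisibility using (_∣_)
open import Data.Nat.GCD using (gcd)
open import Data.Nat.LCM using (lcm)
open import Data.Nat.Primality using (Prime)
open import Data.Fin using (Fin)
open import Data.Product using (Σ; ∃; _×_; _,_)
open import Relation.Binary.PropositionalEquality using (_≡_; _≢_)
open import Relation.Nullary using (¬_)

open import Data.Nat
  using (suc; _∸_; _≟_; NonZero; ≢-nonZero; ≢-nonZero⁻¹; >-nonZero; >-nonZero⁻¹; nonTrivial⇒≢1; z≤n; s≤s)
open import Data.Nat.Properties
open import Data.Nat.Divisibility
open import Data.Nat.DivMod using (_/_; _%_; m≡m%n+[m/n]*n; m%n<n; m/n*n≡m; /-congʳ)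
open import Data.Nat.GCD using (gcd[m,n]∣m; gcd[m,n]∣n; gcd-greatest; gcd[m,n]≢0; n/gcd[m,n]≢0; gcd-comm; module Bézout)
open import Data.Nat.LCM using (lcm-least; gcd*lcm; lcm-comm)
open import Data.Nat.Primality using (euclidsLemma; prime⇒nonZero; prime⇒nonTrivial; prime⇒irreducible)
open import Data.Nat.Primality.Factorisation using (factorise)
open import Data.Nat.Coprimality using (Coprime; coprime-Bézout; coprime-/gcd; coprime⇒gcd≡1)
open import Data.Nat.ListAction using (product)
open import Data.Nat.Tactic.RingSolver using (solve; solve-∀)
open import Data.Fin using (zero; suc)
open import Data.List using ([]; _∷_)
open import Data.List.Relation.Unary.All using () renaming (_∷_ to _∷ᴬ_)
open import Data.Sum using (_⊎_; inj₁; inj₂; [_,_]′)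
open import Data.Empty using (⊥; ⊥-elim)
open import Function using (_∘_; id)
open import Relation.Binary.PropositionalEquality
  using (refl; sym; trans; cong; cong₂; subst; ≢-sym; module ≡-Reasoning)
open import Relation.Nullary using (yes; no; _×-dec_)

gcd-nonZeroˡ : ∀ m n .{{_ : NonZero m}} → NonZero (gcd m n)
gcd-nonZeroˡ m n = ≢-nonZero (gcd[m,n]≢0 m n (inj₁ (≢-nonZero⁻¹ m)))

/gcd-nonZero : ∀ m n .{{_ : NonZero n}} .{{_ : NonZero (gcd m n)}} → NonZero (n / gcd m n)
/gcd-nonZero m n = ≢-nonZero (n/gcd[m,n]≢0 m n)

∤⇒nonZero : ∀ {d n} → ¬ d ∣ n → NonZero n
∤⇒nonZero {d} d∤n = ≢-nonZero λ { refl → d∤n (d ∣0) }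

divisor-nonZero : ∀ {d n} .{{_ : NonZero n}} → d ∣ n → NonZero d
divisor-nonZero {n = n} d∣n = ≢-nonZero λ { refl → ≢-nonZero⁻¹ n (0∣⇒≡0 d∣n) }

prime≢1 : ∀ {p} → Prime p → p ≢ 1
prime≢1 P = nonTrivial⇒≢1 {{prime⇒nonTrivial P}}

prime∣prime⇒≡ : ∀ {p q} → Prime p → Prime q → p ∣ q → p ≡ q
prime∣prime⇒≡ Pp Pq p∣q with prime⇒irreducible Pq p∣q
... | inj₁ p≡1 = ⊥-elim (prime≢1 Pp p≡1)
... | inj₂ p≡q = p≡q

prime∤* : ∀ {p m n} → Prime p → ¬ p ∣ m → ¬ p ∣ n → ¬ p ∣ m * n
prime∤* {m = m} {n} P p∤m p∤n p∣m*n = [ p∤m , p∤n ]′ (euclidsLemma m n P p∣m*n)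

prime∤sq : ∀ {p x} → Prime p → Prime x → p ≢ x → ¬ p ∣ sq x
prime∤sq Pp Px p≢x = prime∤* Pp p∤x p∤x
  where p∤x = p≢x ∘ prime∣prime⇒≡ Pp Px

prime∤sq*sq : ∀ {p x y} → Prime p → Prime x → Prime y → p ≢ x → p ≢ y → ¬ p ∣ sq x * sq y
prime∤sq*sq P Px Py p≢x p≢y = prime∤* P (prime∤sq P Px p≢x) (prime∤sq P Py p≢y)

prime∤sq*sq*sq : ∀ {p x y z} → Prime p → Prime x → Prime y → Prime z →
  p ≢ x → p ≢ y → p ≢ z → ¬ p ∣ sq x * sq y * sq z
prime∤sq*sq*sq P Px Py Pz p≢x p≢y p≢z = prime∤* P (prime∤sq*sq P Px Py p≢x p≢y) (prime∤sq P Pz p≢z)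

∣m*n∧∤n⇒∣m : ∀ {p m n} → Prime p → p ∣ m * n → ¬ p ∣ n → p ∣ m
∣m*n∧∤n⇒∣m {m = m} {n} P p∣m*n p∤n = [ id , ⊥-elim ∘ p∤n ]′ (euclidsLemma m n P p∣m*n)

∣m*n∧∤m⇒∣n : ∀ {p m n} → Prime p → p ∣ m * n → ¬ p ∣ m → p ∣ n
∣m*n∧∤m⇒∣n {m = m} {n} P p∣m*n p∤m = [ ⊥-elim ∘ p∤m , id ]′ (euclidsLemma m n P p∣m*n)

prime²∣m*n∧∤m⇒prime²∣n : ∀ {p m n} → Prime p → ¬ p ∣ m → p * p ∣ m * n → p * p ∣ n
prime²∣m*n∧∤m⇒prime²∣n {p} {m} {n} P p∤m p²∣m*n with ∣m*n∧∤m⇒∣n P (m*n∣⇒m∣ p p p²∣m*n) p∤m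
... | divides j refl = *-monoˡ-∣ p (∣m*n∧∤m⇒∣n P p∣m*j p∤m)
  where
  p∣m*j : p ∣ m * j
  p∣m*j = *-cancelʳ-∣ p {{prime⇒nonZero P}} (subst (p * p ∣_) (sym (*-assoc m j p)) p²∣m*n)

prime-divisor : ∀ {d n} .{{_ : NonZero n}} → d ∣ n → d ≢ 1 → ∃ λ p → Prime p × p ∣ d
prime-divisor {d} d∣n d≢1 with factorise d {{divisor-nonZero d∣n}}
... | record { factors = [] ; isFactorisation = d≡1 } = ⊥-elim (d≢1 d≡1)
... | record { factors = p ∷ ps ; isFactorisation = d≡p*ps ; factorsPrime = P ∷ᴬ _ } =
  p , P , subst (p ∣_) (sym d≡p*ps) (m∣m*n (product ps))

no-common-prime⇒coprime : ∀ {m n} .{{_ : NonZero m}} → (∀ {p} → Prime p → p ∣ m → p ∣ n → ⊥) → Coprime m n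
no-common-prime⇒coprime no-common {d} (d∣m , d∣n) with d ≟ 1
... | yes d≡1 = d≡1
... | no d≢1 with prime-divisor d∣m d≢1
...   | p , P , p∣d = ⊥-elim (no-common P (∣-trans p∣d d∣m) (∣-trans p∣d d∣n))

no-prime-square⇒squarefree : ∀ {n} .{{_ : NonZero n}} → (∀ {p} → Prime p → p * p ∣ n → ⊥) → SquareFree n
no-prime-square⇒squarefree no-square d d²∣n with d ≟ 1
... | yes d≡1 = d≡1
... | no d≢1 with prime-divisor (m*n∣⇒m∣ d d d²∣n) d≢1
...   | p , P , p∣d = ⊥-elim (no-square P (∣-trans (*-pres-∣ p∣d p∣d) d²∣n))

prime²∣m∧n⇒¬squarefree-gcd : ∀ {p m n} → Prime p → p * p ∣ m → p * p ∣ n → ¬ SquareFree (gcd m n)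
prime²∣m∧n⇒¬squarefree-gcd P p²∣m p²∣n squarefree = prime≢1 P (squarefree _ (gcd-greatest p²∣m p²∣n))

gcd4∣idx4 : ∀ a b c d i → gcd4 a b c d ∣ idx4 a b c d i
gcd4∣idx4 a b c d zero =
  ∣-trans (gcd[m,n]∣m (gcd3 a b c) d) (∣-trans (gcd[m,n]∣m (gcd a b) c) (gcd[m,n]∣m a b))
gcd4∣idx4 a b c d (suc zero) =
  ∣-trans (gcd[m,n]∣m (gcd3 a b c) d) (∣-trans (gcd[m,n]∣m (gcd a b) c) (gcd[m,n]∣n a b))
gcd4∣idx4 a b c d (suc (suc zero)) = ∣-trans (gcd[m,n]∣m (gcd3 a b c) d) (gcd[m,n]∣n (gcd a b) c)
gcd4∣idx4 a b c d (suc (suc (suc zero))) = gcd[m,n]∣n (gcd3 a b c) d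

lcm≡m*[n/gcd] : ∀ m n .{{_ : NonZero m}} .{{_ : NonZero (gcd m n)}} → lcm m n ≡ m * (n / gcd m n)
lcm≡m*[n/gcd] (suc _) n = refl

lcm≡n*[m/gcd] : ∀ m n .{{_ : NonZero m}} .{{_ : NonZero n}} .{{_ : NonZero (gcd m n)}} → lcm m n ≡ n * (m / gcd m n)
lcm≡n*[m/gcd] m n = begin
  lcm m n            ≡⟨ lcm-comm m n ⟩
  lcm n m            ≡⟨ lcm≡m*[n/gcd] n m ⟩
  n * (m / gcd n m)  ≡⟨ cong (n *_) (/-congʳ (gcd-comm n m)) ⟩
  n * (m / gcd m n)  ∎
  where
  open ≡-Reasoning
  instance gcd[n,m]≢0 = gcd-nonZeroˡ n m

coprime⇒lcm≡* : ∀ {m n} → Coprime m n → lcm m n ≡ m * n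
coprime⇒lcm≡* {m} {n} coprime = begin
  lcm m n            ≡⟨ *-identityˡ (lcm m n) ⟨
  1 * lcm m n        ≡⟨ cong (_* lcm m n) (coprime⇒gcd≡1 coprime) ⟨
  gcd m n * lcm m n  ≡⟨ gcd*lcm m n ⟩
  m * n              ∎
  where open ≡-Reasoning

coprime⇒∃-solution : ∀ c d .{{_ : NonZero d}} → Coprime c d → ∀ T → ∃ λ w → d ∣ T + c * w
coprime⇒∃-solution c d@(suc d-1) coprime T with coprime-Bézout coprime
... | Bézout.+- x y 1+yd≡xc = T * d-1 * x , divides (T + T * d-1 * y) (begin
  T + c * (T * d-1 * x)          ≡⟨ solve (T ∷ c ∷ d-1 ∷ x ∷ []) ⟩
  T + T * d-1 * (x * c)          ≡⟨ cong (λ z → T + T * d-1 * z) 1+yd≡xc ⟨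
  T + T * d-1 * (1 + y * d)      ≡⟨ solve (T ∷ d-1 ∷ y ∷ []) ⟩
  (T + T * d-1 * y) * d          ∎)
  where open ≡-Reasoning
... | Bézout.-+ x y 1+xc≡yd = T * x , divides (T * y) (begin
  T + c * (T * x)  ≡⟨ solve (T ∷ c ∷ x ∷ []) ⟩
  T * (1 + x * c)  ≡⟨ cong (T *_) 1+xc≡yd ⟩
  T * (y * d)      ≡⟨ *-assoc T y d ⟨
  T * y * d        ∎)
  where open ≡-Reasoning

record BoundedSolution (c d T : ℕ) : Set where
  field
    x : ℕ
    1≤x : 1 ≤ x
    x≤d : x ≤ d
    d∣T+cx : d ∣ T + c * x

-- The solution is moved into [1, d] by writing w + d - 1 = r + q d and taking x = r + 1.
bounded-solution : ∀ c d .{{_ : NonZero d}} → Coprime c d → ∀ T → BoundedSolution c d T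
bounded-solution c d@(suc d-1) coprime T with coprime⇒∃-solution c d coprime T
... | w , d∣T+cw = record
  { x = suc r ; 1≤x = s≤s z≤n ; x≤d = m%n<n (w + d-1) d
  ; d∣T+cx = ∣m+n∣m⇒∣n d∣cdq+[T+cx] (∣m⇒∣m*n q (∣n⇒∣m*n c ∣-refl)) }
  where
  open ≡-Reasoning
  r = (w + d-1) % d
  q = (w + d-1) / d
  w+d≡x+qd : w + d ≡ suc r + q * d
  w+d≡x+qd = trans (+-suc w d-1) (cong suc (m≡m%n+[m/n]*n (w + d-1) d))
  regroup : ∀ r q → c * d * q + (T + c * suc r) ≡ T + c * (suc r + q * d)
  regroup r q = solve (c ∷ d-1 ∷ q ∷ T ∷ r ∷ [])
  d∣cdq+[T+cx] : d ∣ c * d * q + (T + c * suc r)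
  d∣cdq+[T+cx] = subst (d ∣_) (begin
    T + c * w + c * d        ≡⟨ +-assoc T (c * w) (c * d) ⟩
    T + (c * w + c * d)      ≡⟨ cong (T +_) (*-distribˡ-+ c w d) ⟨
    T + c * (w + d)          ≡⟨ cong (λ z → T + c * z) w+d≡x+qd ⟩
    T + c * (suc r + q * d)  ≡⟨ regroup r q ⟨
    c * d * q + (T + c * suc r) ∎) (∣m∣n⇒∣m+n d∣T+cw (∣n⇒∣m*n c ∣-refl))

record BoundedSolution₂ (b₁ b₂ b₃ T : ℕ) : Set where
  field
    x₁ x₂ : ℕ
    1≤x₁ : 1 ≤ x₁
    1≤x₂ : 1 ≤ x₂
    b₁x₁≤lcm : b₁ * x₁ ≤ lcm b₁ b₃
    b₂x₂≤lcm : b₂ * x₂ ≤ lcm b₂ (gcd b₁ b₃)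
    b₃∣T+S : b₃ ∣ T + (b₁ * x₁ + b₂ * x₂)

-- First x₂ makes T + b₂ x₂ a multiple k g of g = gcd b₁ b₃, then x₁ solves k + (b₁/g) x₁ ≡ 0 mod b₃/g.
bounded-solution₂ : ∀ b₁ b₂ b₃ .{{_ : NonZero b₁}} .{{_ : NonZero b₃}} → Coprime b₂ (gcd b₁ b₃) → ∀ T →
  BoundedSolution₂ b₁ b₂ b₃ T
bounded-solution₂ b₁ b₂ b₃ coprime T = record
  { x₁ = x₁ ; x₂ = x₂ ; 1≤x₁ = 1≤x₁ ; 1≤x₂ = 1≤x₂
  ; b₁x₁≤lcm = subst (b₁ * x₁ ≤_) (sym (lcm≡m*[n/gcd] b₁ b₃)) (*-monoʳ-≤ b₁ x₁≤b₃/g)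
  ; b₂x₂≤lcm = subst (b₂ * x₂ ≤_) (sym (coprime⇒lcm≡* coprime)) (*-monoʳ-≤ b₂ x₂≤g)
  ; b₃∣T+S = divides j T+S≡jb₃ }
  where
  open ≡-Reasoning
  g = gcd b₁ b₃
  instance g≢0 = gcd-nonZeroˡ b₁ b₃
  open BoundedSolution (bounded-solution b₂ g coprime T)
    renaming (x to x₂; 1≤x to 1≤x₂; x≤d to x₂≤g; d∣T+cx to g∣T+b₂x₂)
  open _∣_ g∣T+b₂x₂ renaming (quotient to k; equality to T+b₂x₂≡kg)
  open BoundedSolution (bounded-solution (b₁ / g) (b₃ / g) {{/gcd-nonZero b₁ b₃}} (coprime-/gcd b₁ b₃) k)
    renaming (x to x₁; 1≤x to 1≤x₁; x≤d to x₁≤b₃/g; d∣T+cx to e∣k+cx₁)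
  open _∣_ e∣k+cx₁ renaming (quotient to j; equality to k+cx₁≡je)
  regroup : ∀ T c h x b y → T + (c * h * x + b * y) ≡ (T + b * y) + c * x * h
  regroup = solve-∀
  T+S≡jb₃ : T + (b₁ * x₁ + b₂ * x₂) ≡ j * b₃
  T+S≡jb₃ = begin
    T + (b₁ * x₁ + b₂ * x₂)          ≡⟨ cong (λ b → T + (b * x₁ + b₂ * x₂)) (m/n*n≡m (gcd[m,n]∣m b₁ b₃)) ⟨
    T + (b₁ / g * g * x₁ + b₂ * x₂)  ≡⟨ regroup T (b₁ / g) g x₁ b₂ x₂ ⟩
    (T + b₂ * x₂) + b₁ / g * x₁ * g  ≡⟨ cong (_+ b₁ / g * x₁ * g) T+b₂x₂≡kg ⟩
    k * g + b₁ / g * x₁ * g          ≡⟨ *-distribʳ-+ g k (b₁ / g * x₁) ⟨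
    (k + b₁ / g * x₁) * g            ≡⟨ cong (_* g) k+cx₁≡je ⟩
    j * (b₃ / g) * g                 ≡⟨ *-assoc j (b₃ / g) g ⟩
    j * (b₃ / g * g)                 ≡⟨ cong (j *_) (m/n*n≡m (gcd[m,n]∣n b₁ b₃)) ⟩
    j * b₃                           ∎

∣[d∸1]*n+m⇒∣n∸m : ∀ d {m n} .{{_ : NonZero d}} → m ≤ n → d ∣ (d ∸ 1) * n + m → d ∣ n ∸ m
∣[d∸1]*n+m⇒∣n∸m d@(suc d-1) {m} {n} m≤n d∣ = ∣m+n∣m⇒∣n (subst (d ∣_) (sym split) (m∣m*n n)) d∣
  where
  split : d-1 * n + m + (n ∸ m) ≡ d * n
  split = trans (+-assoc (d-1 * n) m (n ∸ m)) (trans (cong (d-1 * n +_) (m+[n∸m]≡n m≤n)) (+-comm (d-1 * n) n))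

record Representation₃ (b₁ b₂ b₃ k N : ℕ) : Set where
  field
    x₁ x₂ y : ℕ
    1≤x₁ : 1 ≤ x₁
    1≤x₂ : 1 ≤ x₂
    k≤y : k ≤ y
    N≡ : N ≡ b₁ * x₁ + b₂ * x₂ + b₃ * y

-- Solving the congruence with T = (b₃ - 1) N makes N - b₁ x₁ - b₂ x₂ a multiple of b₃.
representation₃ : ∀ b₁ b₂ b₃ .{{_ : NonZero b₁}} .{{_ : NonZero b₃}} → Coprime b₂ (gcd b₁ b₃) →
  ∀ k {N} → b₃ * k + (lcm b₁ b₃ + lcm b₂ (gcd b₁ b₃)) ≤ N → Representation₃ b₁ b₂ b₃ k N
representation₃ b₁ b₂ b₃ coprime k {N} N≥ = record
  { x₁ = x₁ ; x₂ = x₂ ; y = y ; 1≤x₁ = 1≤x₁ ; 1≤x₂ = 1≤x₂ ; k≤y = k≤y ; N≡ = N≡S+b₃y }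
  where
  open BoundedSolution₂ (bounded-solution₂ b₁ b₂ b₃ coprime ((b₃ ∸ 1) * N))
  S = b₁ * x₁ + b₂ * x₂
  b₃k+S≤N : b₃ * k + S ≤ N
  b₃k+S≤N = ≤-trans (+-monoʳ-≤ (b₃ * k) (+-mono-≤ b₁x₁≤lcm b₂x₂≤lcm)) N≥
  S≤N : S ≤ N
  S≤N = m+n≤o⇒n≤o (b₃ * k) b₃k+S≤N
  open _∣_ (∣[d∸1]*n+m⇒∣n∸m b₃ S≤N b₃∣T+S) renaming (quotient to y; equality to N∸S≡yb₃)
  N∸S≡b₃y : N ∸ S ≡ b₃ * y
  N∸S≡b₃y = trans N∸S≡yb₃ (*-comm y b₃)
  k≤y : k ≤ y
  k≤y = *-cancelˡ-≤ b₃ (subst (b₃ * k ≤_) N∸S≡b₃y (m+n≤o⇒m≤o∸n (b₃ * k) b₃k+S≤N))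
  N≡S+b₃y : N ≡ S + b₃ * y
  N≡S+b₃y = trans (sym (m+[n∸m]≡n S≤N)) (cong (S +_) N∸S≡b₃y)

-- M = bA tA = bB tB can be traded between the two coefficients of bA A + bB B.
record Exchange (p bA bB M tA tB : ℕ) : Set where
  field
    M≡bA*tA : M ≡ bA * tA
    M≡bB*tB : M ≡ bB * tB
    p∤tA⊎p∤tB : ¬ p ∣ tA ⊎ ¬ p ∣ tB

  bA∣M : bA ∣ M
  bA∣M = divides tA (trans M≡bA*tA (*-comm bA tA))

  bB∣M : bB ∣ M
  bB∣M = divides tB (trans M≡bB*tB (*-comm bB tB))

  M-nonZero : .{{_ : NonZero bA}} .{{_ : NonZero bB}} → NonZero M
  M-nonZero with p∤tA⊎p∤tB
  ... | inj₁ p∤tA = subst NonZero (sym M≡bA*tA) (m*n≢0 bA tA)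
    where instance tA-nonZero = ∤⇒nonZero p∤tA
  ... | inj₂ p∤tB = subst NonZero (sym M≡bB*tB) (m*n≢0 bB tB)
    where instance tB-nonZero = ∤⇒nonZero p∤tB

lcm-exchange : ∀ {p} a b {cA cB U V W} .{{_ : NonZero a}} .{{_ : NonZero b}} .{{_ : NonZero (gcd a b)}} →
  Prime p →
  cA * U ≡ W → cB * V ≡ W → ¬ p ∣ U → ¬ p ∣ V →
  Exchange p (a * cA) (b * cB) (lcm a b * W) (b / gcd a b * U) (a / gcd a b * V)
lcm-exchange {p} a b {cA} {cB} {U} {V} {W} P cAU≡W cBV≡W p∤U p∤V = record
  { M≡bA*tA = lcm*W≡ a cA (b / g) U (lcm≡m*[n/gcd] a b) cAU≡W
  ; M≡bB*tB = lcm*W≡ b cB (a / g) V (lcm≡n*[m/gcd] a b) cBV≡W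
  ; p∤tA⊎p∤tB = not-both
  }
  where
  open ≡-Reasoning
  g = gcd a b
  lcm*W≡ : ∀ c c′ e X → lcm a b ≡ c * e → c′ * X ≡ W → lcm a b * W ≡ c * c′ * (e * X)
  lcm*W≡ c c′ e X L≡ce c′X≡W = begin
    lcm a b * W        ≡⟨ cong₂ _*_ L≡ce (sym c′X≡W) ⟩
    c * e * (c′ * X)   ≡⟨ solve (c ∷ e ∷ c′ ∷ X ∷ []) ⟩
    c * c′ * (e * X)   ∎
  not-both : ¬ p ∣ b / g * U ⊎ ¬ p ∣ a / g * V
  not-both with p ∣? b / g * U
  ... | no p∤tA = inj₁ p∤tA
  ... | yes p∣tA = inj₂ λ p∣tB → prime≢1 P
    (coprime-/gcd a b (∣m*n∧∤n⇒∣m P p∣tB p∤V , ∣m*n∧∤n⇒∣m P p∣tA p∤U))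

record Exchanged (p bA bB tA tB A B : ℕ) : Set where
  field
    A′ B′ : ℕ
    sum≡ : bA * A′ + bB * B′ ≡ bA * A + bB * (B + tB)
    A≤A′ : A ≤ A′
    B≤B′ : B ≤ B′
    back-A : ∀ {d} → d ∣ tA → d ∣ A′ → d ∣ A
    back-B : ∀ {d} → d ∣ tB → d ∣ B′ → d ∣ B + tB
    ¬p²∣A′∧B′ : ¬ (p * p ∣ A′ × p * p ∣ B′)

exchange : ∀ {p bA bB M tA tB} → Exchange p bA bB M tA tB → ∀ A B → Exchanged p bA bB tA tB A B
exchange {p} {bA} {bB} {tA = tA} {tB} E A B with p * p ∣? A ×-dec p * p ∣? B + tB
... | no ¬both = record
  { A′ = A ; B′ = B + tB ; sum≡ = refl ; A≤A′ = ≤-refl ; B≤B′ = m≤m+n B tB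
  ; back-A = λ _ → id ; back-B = λ _ → id ; ¬p²∣A′∧B′ = ¬both }
... | yes (p²∣A , p²∣B+tB) = record
  { A′ = A + tA ; B′ = B ; sum≡ = moved ; A≤A′ = m≤m+n A tA ; B≤B′ = ≤-refl
  ; back-A = d∣A ; back-B = λ d∣tB d∣B → ∣m∣n⇒∣m+n d∣B d∣tB ; ¬p²∣A′∧B′ = ¬both }
  where
  open Exchange E
  open ≡-Reasoning
  moved : bA * (A + tA) + bB * B ≡ bA * A + bB * (B + tB)
  moved = begin
    bA * (A + tA) + bB * B         ≡⟨ cong (_+ bB * B) (*-distribˡ-+ bA A tA) ⟩
    bA * A + bA * tA + bB * B      ≡⟨ cong (λ z → bA * A + z + bB * B) (trans (sym M≡bA*tA) M≡bB*tB) ⟩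
    bA * A + bB * tB + bB * B      ≡⟨ +-assoc (bA * A) (bB * tB) (bB * B) ⟩
    bA * A + (bB * tB + bB * B)    ≡⟨ cong (bA * A +_) (trans (+-comm (bB * tB) (bB * B)) (sym (*-distribˡ-+ bB B tB))) ⟩
    bA * A + bB * (B + tB)         ∎
  d∣A : ∀ {d} → d ∣ tA → d ∣ A + tA → d ∣ A
  d∣A {d} d∣tA d∣A+tA = ∣m+n∣m⇒∣n (subst (d ∣_) (+-comm A tA) d∣A+tA) d∣tA
  p∣ : ∀ {n} → p * p ∣ n → p ∣ n
  p∣ = m*n∣⇒m∣ p p
  ¬both : ¬ (p * p ∣ A + tA × p * p ∣ B)
  ¬both (p²∣A+tA , p²∣B) =
    [ (λ p∤tA → p∤tA (∣m+n∣m⇒∣n (p∣ p²∣A+tA) (p∣ p²∣A)))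
    , (λ p∤tB → p∤tB (∣m+n∣m⇒∣n (p∣ p²∣B+tB) (p∣ p²∣B))) ]′ p∤tA⊎p∤tB

record Representation (p q r b₁ b₂ b₃ m : ℕ) : Set where
  field
    X₁ X₂ X₃ : ℕ
    1≤X₁ : 1 ≤ X₁
    1≤X₂ : 1 ≤ X₂
    1≤X₃ : 1 ≤ X₃
    m≡ : m ≡ b₁ * X₁ + b₂ * X₂ + b₃ * X₃
    ¬p²∣X₁∧X₂ : ¬ (p * p ∣ X₁ × p * p ∣ X₂)
    ¬q²∣X₁∧X₃ : ¬ (q * q ∣ X₁ × q * q ∣ X₃)
    ¬r²∣X₂∧X₃ : ¬ (r * r ∣ X₂ × r * r ∣ X₃)

module _ {p q r b₁ b₂ b₃ M₁₂ M₁₃ M₂₃ s₁ s₂ t₁ t₃ u₂ u₃ : ℕ}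
  .{{_ : NonZero b₁}} .{{_ : NonZero b₂}} .{{_ : NonZero b₃}}
  (coprime : Coprime b₂ (gcd b₁ b₃))
  (E₁₂ : Exchange p b₁ b₂ M₁₂ s₁ s₂) (E₁₃ : Exchange q b₁ b₃ M₁₃ t₁ t₃) (E₂₃ : Exchange r b₂ b₃ M₂₃ u₂ u₃)
  where

  representation₃-bound : ∀ {m} → b₃ + 2 * (M₁₃ + M₂₃) + M₁₂ ≤ m →
    b₃ * (1 + u₃ + t₃) + (lcm b₁ b₃ + lcm b₂ (gcd b₁ b₃)) ≤ m ∸ M₁₂
  representation₃-bound {m} m≥ = m+n≤o⇒m≤o∸n _ (≤-trans (+-monoˡ-≤ M₁₂ bound) m≥)
    where
    open ≤-Reasoning
    open Exchange E₁₃ using (bA∣M; bB∣M; M≡bB*tB) renaming (M-nonZero to M₁₃-nonZero)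
    open Exchange E₂₃ using () renaming (bA∣M to b₂∣M₂₃; bB∣M to b₃∣M₂₃; M≡bB*tB to M₂₃≡b₃u₃; M-nonZero to M₂₃-nonZero)
    lcm₁₃≤M₁₃ : lcm b₁ b₃ ≤ M₁₃
    lcm₁₃≤M₁₃ = ∣⇒≤ {{M₁₃-nonZero}} (lcm-least bA∣M bB∣M)
    lcm₂₃≤M₂₃ : lcm b₂ (gcd b₁ b₃) ≤ M₂₃
    lcm₂₃≤M₂₃ = ∣⇒≤ {{M₂₃-nonZero}} (lcm-least b₂∣M₂₃ (∣-trans (gcd[m,n]∣n b₁ b₃) b₃∣M₂₃))
    expand : ∀ b u t → b * (1 + u + t) + (b * t + b * u) ≡ b + 2 * (b * t + b * u)
    expand = solve-∀
    bound : b₃ * (1 + u₃ + t₃) + (lcm b₁ b₃ + lcm b₂ (gcd b₁ b₃)) ≤ b₃ + 2 * (M₁₃ + M₂₃)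
    bound = begin
      b₃ * (1 + u₃ + t₃) + (lcm b₁ b₃ + lcm b₂ (gcd b₁ b₃)) ≤⟨ +-monoʳ-≤ (b₃ * (1 + u₃ + t₃)) (+-mono-≤ lcm₁₃≤M₁₃ lcm₂₃≤M₂₃) ⟩
      b₃ * (1 + u₃ + t₃) + (M₁₃ + M₂₃)                     ≡⟨ cong₂ (λ x y → b₃ * (1 + u₃ + t₃) + (x + y)) M≡bB*tB M₂₃≡b₃u₃ ⟩
      b₃ * (1 + u₃ + t₃) + (b₃ * t₃ + b₃ * u₃)             ≡⟨ expand b₃ u₃ t₃ ⟩
      b₃ + 2 * (b₃ * t₃ + b₃ * u₃)                         ≡⟨ cong₂ (λ x y → b₃ + 2 * (x + y)) M≡bB*tB M₂₃≡b₃u₃ ⟨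
      b₃ + 2 * (M₁₃ + M₂₃)                                 ∎

  exchanges-preserve-value : ∀ {m x₁ x₂ y X₁ X₂ X₁′ Y X₂′ Z} →
    m ≡ b₁ * x₁ + b₂ * x₂ + b₃ * y + M₁₂ →
    b₁ * X₁ + b₂ * X₂ ≡ b₁ * x₁ + b₂ * (x₂ + s₂) →
    b₁ * X₁′ + b₃ * Y ≡ b₁ * X₁ + b₃ * y →
    b₂ * X₂′ + b₃ * Z ≡ b₂ * X₂ + b₃ * Y →
    m ≡ b₁ * X₁′ + b₂ * X₂′ + b₃ * Z
  exchanges-preserve-value {m} {x₁} {x₂} {y} {X₁} {X₂} {X₁′} {Y} {X₂′} {Z} m≡ e₁₂ e₁₃ e₂₃ = begin
    m                                     ≡⟨ m≡ ⟩
    b₁ * x₁ + b₂ * x₂ + b₃ * y + M₁₂      ≡⟨ cong (b₁ * x₁ + b₂ * x₂ + b₃ * y +_) (Exchange.M≡bB*tB E₁₂) ⟩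
    b₁ * x₁ + b₂ * x₂ + b₃ * y + b₂ * s₂  ≡⟨ solve (b₁ ∷ b₂ ∷ b₃ ∷ x₁ ∷ x₂ ∷ y ∷ s₂ ∷ []) ⟩
    b₁ * x₁ + b₂ * (x₂ + s₂) + b₃ * y     ≡⟨ cong (_+ b₃ * y) e₁₂ ⟨
    b₁ * X₁ + b₂ * X₂ + b₃ * y            ≡⟨ solve (b₁ ∷ b₂ ∷ b₃ ∷ X₁ ∷ X₂ ∷ y ∷ []) ⟩
    b₂ * X₂ + (b₁ * X₁ + b₃ * y)          ≡⟨ cong (b₂ * X₂ +_) e₁₃ ⟨
    b₂ * X₂ + (b₁ * X₁′ + b₃ * Y)         ≡⟨ solve (b₁ ∷ b₂ ∷ b₃ ∷ X₁′ ∷ X₂ ∷ Y ∷ []) ⟩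
    b₁ * X₁′ + (b₂ * X₂ + b₃ * Y)         ≡⟨ cong (b₁ * X₁′ +_) e₂₃ ⟨
    b₁ * X₁′ + (b₂ * X₂′ + b₃ * Z)        ≡⟨ +-assoc (b₁ * X₁′) (b₂ * X₂′) (b₃ * Z) ⟨
    b₁ * X₁′ + b₂ * X₂′ + b₃ * Z          ∎
    where open ≡-Reasoning

  -- Three successive exchanges repair the pairs (1,2), (1,3), (2,3); a later exchange changes
  -- coordinates only by multiples of p² or q², so it cannot spoil a pair already repaired.
  three-term-representation : p * p ∣ t₁ → p * p ∣ u₂ → q * q ∣ u₃ →
    ∀ {m} → b₃ + 2 * (M₁₃ + M₂₃) + M₁₂ ≤ m → Representation p q r b₁ b₂ b₃ m
  three-term-representation p²∣t₁ p²∣u₂ q²∣u₃ {m} m≥ = record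
    { X₁ = X₁′ ; X₂ = X₂′ ; X₃ = Z
    ; 1≤X₁ = ≤-trans Init.1≤x₁ (≤-trans Fix₁₂.A≤A′ Fix₁₃.A≤A′)
    ; 1≤X₂ = ≤-trans Init.1≤x₂ (≤-trans Fix₁₂.B≤B′ Fix₂₃.A≤A′)
    ; 1≤X₃ = ≤-trans (m+n≤o⇒m≤o∸n 1 1+u₃≤Y) Fix₂₃.B≤B′
    ; m≡ = exchanges-preserve-value
        (trans (sym (m∸n+n≡m (m+n≤o⇒n≤o (b₃ + 2 * (M₁₃ + M₂₃)) m≥))) (cong (_+ M₁₂) Init.N≡))
        Fix₁₂.sum≡
        (trans Fix₁₃.sum≡ (cong (λ z → b₁ * X₁ + b₃ * z) (m∸n+n≡m t₃≤y)))
        (trans Fix₂₃.sum≡ (cong (λ z → b₂ * X₂ + b₃ * z) Y∸u₃+u₃≡Y))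
    ; ¬p²∣X₁∧X₂ = λ (h₁ , h₂) → Fix₁₂.¬p²∣A′∧B′ (Fix₁₃.back-A p²∣t₁ h₁ , Fix₂₃.back-A p²∣u₂ h₂)
    ; ¬q²∣X₁∧X₃ = λ (h₁ , h₃) → Fix₁₃.¬p²∣A′∧B′ (h₁ , subst (q * q ∣_) Y∸u₃+u₃≡Y (Fix₂₃.back-B q²∣u₃ h₃))
    ; ¬r²∣X₂∧X₃ = Fix₂₃.¬p²∣A′∧B′
    }
    where
    module Init = Representation₃ (representation₃ b₁ b₂ b₃ coprime (1 + u₃ + t₃) (representation₃-bound m≥))
    open Init using (x₁; x₂; y; k≤y)
    module Fix₁₂ = Exchanged (exchange E₁₂ x₁ x₂)
    open Fix₁₂ using () renaming (A′ to X₁; B′ to X₂)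
    module Fix₁₃ = Exchanged (exchange E₁₃ X₁ (y ∸ t₃))
    open Fix₁₃ using () renaming (A′ to X₁′; B′ to Y)
    module Fix₂₃ = Exchanged (exchange E₂₃ X₂ (Y ∸ u₃))
    open Fix₂₃ using () renaming (A′ to X₂′; B′ to Z)
    t₃≤y : t₃ ≤ y
    t₃≤y = m+n≤o⇒n≤o (1 + u₃) k≤y
    1+u₃≤Y : 1 + u₃ ≤ Y
    1+u₃≤Y = ≤-trans (m+n≤o⇒m≤o∸n (1 + u₃) k≤y) Fix₁₃.B≤B′
    Y∸u₃+u₃≡Y : Y ∸ u₃ + u₃ ≡ Y
    Y∸u₃+u₃≡Y = m∸n+n≡m (m+n≤o⇒n≤o 1 1+u₃≤Y)

sq-nonZero : ∀ {p} → Prime p → NonZero (sq p)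
sq-nonZero {p} P = m*n≢0 p p
  where instance p≢0 = prime⇒nonZero P

sq*sq*sq-nonZero : ∀ {x y z} → Prime x → Prime y → Prime z → NonZero (sq x * sq y * sq z)
sq*sq*sq-nonZero {x} {y} {z} Px Py Pz = m*n≢0 (sq x * sq y) (sq z)
  where
  instance
    x²≢0 = sq-nonZero Px
    y²≢0 = sq-nonZero Py
    z²≢0 = sq-nonZero Pz
    x²y²≢0 = m*n≢0 (sq x) (sq y)

module Construction
  (a₁ a₂ a₃ a₄ : ℕ) (0<a₁ : 0 < a₁) (0<a₂ : 0 < a₂) (0<a₃ : 0 < a₃)
  (gcd₃≡1 : gcd3 a₁ a₂ a₃ ≡ 1)
  (p₁₂ p₁₃ p₁₄ p₂₃ p₂₄ p₃₄ : ℕ)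
  (P₁₂ : Prime p₁₂) (P₁₃ : Prime p₁₃) (P₁₄ : Prime p₁₄) (P₂₃ : Prime p₂₃) (P₂₄ : Prime p₂₄) (P₃₄ : Prime p₃₄)
  (p₁₂≢p₁₃ : p₁₂ ≢ p₁₃) (p₁₂≢p₁₄ : p₁₂ ≢ p₁₄) (p₁₂≢p₂₃ : p₁₂ ≢ p₂₃) (p₁₂≢p₂₄ : p₁₂ ≢ p₂₄) (p₁₂≢p₃₄ : p₁₂ ≢ p₃₄)
  (p₁₃≢p₁₄ : p₁₃ ≢ p₁₄) (p₁₃≢p₂₃ : p₁₃ ≢ p₂₃) (p₁₃≢p₂₄ : p₁₃ ≢ p₂₄) (p₁₃≢p₃₄ : p₁₃ ≢ p₃₄)
  (p₁₄≢p₂₃ : p₁₄ ≢ p₂₃) (p₁₄≢p₂₄ : p₁₄ ≢ p₂₄) (p₁₄≢p₃₄ : p₁₄ ≢ p₃₄)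
  (p₂₃≢p₂₄ : p₂₃ ≢ p₂₄) (p₂₃≢p₃₄ : p₂₃ ≢ p₃₄)
  (p₂₄≢p₃₄ : p₂₄ ≢ p₃₄)
  (p₁₄∤a₁ : ¬ p₁₄ ∣ a₁) (p₂₄∤a₂ : ¬ p₂₄ ∣ a₂) (p₃₄∤a₃ : ¬ p₃₄ ∣ a₃)
  (p₁₂∤gcd : ¬ p₁₂ ∣ gcd a₁ a₂) (p₁₃∤gcd : ¬ p₁₃ ∣ gcd a₁ a₃) (p₂₃∤gcd : ¬ p₂₃ ∣ gcd a₂ a₃)
  where

  A₁ A₂ A₃ A₄ : ℕ
  A₁ = sq p₂₃ * sq p₂₄ * sq p₃₄
  A₂ = sq p₁₃ * sq p₁₄ * sq p₃₄
  A₃ = sq p₁₂ * sq p₁₄ * sq p₂₄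
  A₄ = sq p₁₂ * sq p₁₃ * sq p₂₃

  b₁ b₂ b₃ : ℕ
  b₁ = a₁ * A₁
  b₂ = a₂ * A₂
  b₃ = a₃ * A₃

  instance
    a₁≢0 = >-nonZero 0<a₁
    a₂≢0 = >-nonZero 0<a₂
    a₃≢0 = >-nonZero 0<a₃
    A₁≢0 = sq*sq*sq-nonZero P₂₃ P₂₄ P₃₄
    A₂≢0 = sq*sq*sq-nonZero P₁₃ P₁₄ P₃₄
    A₃≢0 = sq*sq*sq-nonZero P₁₂ P₁₄ P₂₄
    A₄≢0 = sq*sq*sq-nonZero P₁₂ P₁₃ P₂₃
    b₁≢0 = m*n≢0 a₁ A₁
    b₂≢0 = m*n≢0 a₂ A₂
    b₃≢0 = m*n≢0 a₃ A₃
    gcd₁₂≢0 = gcd-nonZeroˡ a₁ a₂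
    gcd₁₃≢0 = gcd-nonZeroˡ a₁ a₃
    gcd₂₃≢0 = gcd-nonZeroˡ a₂ a₃

  ∤A₁ : ∀ {π} → Prime π → π ≢ p₂₃ → π ≢ p₂₄ → π ≢ p₃₄ → ¬ π ∣ A₁
  ∤A₁ P = prime∤sq*sq*sq P P₂₃ P₂₄ P₃₄

  ∤A₂ : ∀ {π} → Prime π → π ≢ p₁₃ → π ≢ p₁₄ → π ≢ p₃₄ → ¬ π ∣ A₂
  ∤A₂ P = prime∤sq*sq*sq P P₁₃ P₁₄ P₃₄

  ∤A₃ : ∀ {π} → Prime π → π ≢ p₁₂ → π ≢ p₁₄ → π ≢ p₂₄ → ¬ π ∣ A₃
  ∤A₃ P = prime∤sq*sq*sq P P₁₂ P₁₄ P₂₄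

  ∤A₄ : ∀ {π} → Prime π → π ≢ p₁₂ → π ≢ p₁₃ → π ≢ p₂₃ → ¬ π ∣ A₄
  ∤A₄ P = prime∤sq*sq*sq P P₁₂ P₁₃ P₂₃

  no-common-prime : ∀ {π} → Prime π → π ∣ b₁ → π ∣ b₂ → π ∣ b₃ → ⊥
  no-common-prime {π} P π∣b₁ π∣b₂ π∣b₃
    with π ≟ p₁₂ | π ≟ p₁₃ | π ≟ p₂₃ | π ≟ p₁₄ | π ≟ p₂₄ | π ≟ p₃₄
  ... | yes refl | _ | _ | _ | _ | _ = p₁₂∤gcd (gcd-greatest {a₁} {a₂}
    (∣m*n∧∤n⇒∣m P π∣b₁ (∤A₁ P p₁₂≢p₂₃ p₁₂≢p₂₄ p₁₂≢p₃₄))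
    (∣m*n∧∤n⇒∣m P π∣b₂ (∤A₂ P p₁₂≢p₁₃ p₁₂≢p₁₄ p₁₂≢p₃₄)))
  ... | no _ | yes refl | _ | _ | _ | _ = p₁₃∤gcd (gcd-greatest {a₁} {a₃}
    (∣m*n∧∤n⇒∣m P π∣b₁ (∤A₁ P p₁₃≢p₂₃ p₁₃≢p₂₄ p₁₃≢p₃₄))
    (∣m*n∧∤n⇒∣m P π∣b₃ (∤A₃ P (≢-sym p₁₂≢p₁₃) p₁₃≢p₁₄ p₁₃≢p₂₄)))
  ... | no _ | no _ | yes refl | _ | _ | _ = p₂₃∤gcd (gcd-greatest {a₂} {a₃}
    (∣m*n∧∤n⇒∣m P π∣b₂ (∤A₂ P (≢-sym p₁₃≢p₂₃) (≢-sym p₁₄≢p₂₃) p₂₃≢p₃₄))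
    (∣m*n∧∤n⇒∣m P π∣b₃ (∤A₃ P (≢-sym p₁₂≢p₂₃) (≢-sym p₁₄≢p₂₃) p₂₃≢p₂₄)))
  ... | no _ | no _ | no _ | yes refl | _ | _ =
    p₁₄∤a₁ (∣m*n∧∤n⇒∣m P π∣b₁ (∤A₁ P p₁₄≢p₂₃ p₁₄≢p₂₄ p₁₄≢p₃₄))
  ... | no _ | no _ | no _ | no _ | yes refl | _ =
    p₂₄∤a₂ (∣m*n∧∤n⇒∣m P π∣b₂ (∤A₂ P (≢-sym p₁₃≢p₂₄) (≢-sym p₁₄≢p₂₄) p₂₄≢p₃₄))
  ... | no _ | no _ | no _ | no _ | no _ | yes refl =
    p₃₄∤a₃ (∣m*n∧∤n⇒∣m P π∣b₃ (∤A₃ P (≢-sym p₁₂≢p₃₄) (≢-sym p₁₄≢p₃₄) (≢-sym p₂₄≢p₃₄)))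
  ... | no π≢p₁₂ | no π≢p₁₃ | no π≢p₂₃ | no π≢p₁₄ | no π≢p₂₄ | no π≢p₃₄ =
    prime≢1 P (∣1⇒≡1 (subst (π ∣_) gcd₃≡1 (gcd-greatest {gcd a₁ a₂} {a₃} (gcd-greatest {a₁} {a₂}
      (∣m*n∧∤n⇒∣m P π∣b₁ (∤A₁ P π≢p₂₃ π≢p₂₄ π≢p₃₄))
      (∣m*n∧∤n⇒∣m P π∣b₂ (∤A₂ P π≢p₁₃ π≢p₁₄ π≢p₃₄)))
      (∣m*n∧∤n⇒∣m P π∣b₃ (∤A₃ P π≢p₁₂ π≢p₁₄ π≢p₂₄)))))

  coprime : Coprime b₂ (gcd b₁ b₃)
  coprime = no-common-prime⇒coprime λ P π∣b₂ π∣g →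
    no-common-prime P (∣-trans π∣g (gcd[m,n]∣m b₁ b₃)) π∣b₂ (∣-trans π∣g (gcd[m,n]∣n b₁ b₃))

  M₁₂ M₁₃ M₂₃ : ℕ
  M₁₂ = lcm a₁ a₂ * (A₁ * (sq p₁₃ * sq p₁₄))
  M₁₃ = lcm a₁ a₃ * (A₁ * (sq p₁₂ * sq p₁₄))
  M₂₃ = lcm a₂ a₃ * (A₂ * (sq p₁₂ * sq p₂₄))

  E₁₂ : Exchange p₁₂ b₁ b₂ M₁₂ (a₂ / gcd a₁ a₂ * (sq p₁₃ * sq p₁₄)) (a₁ / gcd a₁ a₂ * (sq p₂₃ * sq p₂₄))
  E₁₂ = lcm-exchange a₁ a₂ P₁₂ refl (regroup (sq p₁₃) (sq p₁₄) (sq p₃₄) (sq p₂₃) (sq p₂₄))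
    (prime∤sq*sq P₁₂ P₁₃ P₁₄ p₁₂≢p₁₃ p₁₂≢p₁₄) (prime∤sq*sq P₁₂ P₂₃ P₂₄ p₁₂≢p₂₃ p₁₂≢p₂₄)
    where
    regroup : ∀ x y c u v → x * y * c * (u * v) ≡ u * v * c * (x * y)
    regroup = solve-∀

  E₁₃ : Exchange p₁₃ b₁ b₃ M₁₃ (a₃ / gcd a₁ a₃ * (sq p₁₂ * sq p₁₄)) (a₁ / gcd a₁ a₃ * (sq p₂₃ * sq p₃₄))
  E₁₃ = lcm-exchange a₁ a₃ P₁₃ refl (regroup (sq p₁₂) (sq p₁₄) (sq p₂₄) (sq p₂₃) (sq p₃₄))
    (prime∤sq*sq P₁₃ P₁₂ P₁₄ (≢-sym p₁₂≢p₁₃) p₁₃≢p₁₄) (prime∤sq*sq P₁₃ P₂₃ P₃₄ p₁₃≢p₂₃ p₁₃≢p₃₄)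
    where
    regroup : ∀ x y c u v → x * y * c * (u * v) ≡ u * c * v * (x * y)
    regroup = solve-∀

  E₂₃ : Exchange p₂₃ b₂ b₃ M₂₃ (a₃ / gcd a₂ a₃ * (sq p₁₂ * sq p₂₄)) (a₂ / gcd a₂ a₃ * (sq p₁₃ * sq p₃₄))
  E₂₃ = lcm-exchange a₂ a₃ P₂₃ refl (regroup (sq p₁₂) (sq p₁₄) (sq p₂₄) (sq p₁₃) (sq p₃₄))
    (prime∤sq*sq P₂₃ P₁₂ P₂₄ (≢-sym p₁₂≢p₂₃) p₂₃≢p₂₄) (prime∤sq*sq P₂₃ P₁₃ P₃₄ (≢-sym p₁₃≢p₂₃) p₂₃≢p₃₄)
    where
    regroup : ∀ x c y u v → x * c * y * (u * v) ≡ u * c * v * (x * y)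
    regroup = solve-∀

  threshold : ℕ
  threshold = a₃ * sq p₁₂ * sq p₁₄ * sq p₂₄
    + a₄ * sq p₁₂ * sq p₁₃ * sq p₂₃
    + lcm a₁ a₂ * sq p₁₃ * sq p₁₄ * sq p₂₃ * sq p₂₄ * sq p₃₄
    + 2 * lcm a₁ a₃ * sq p₁₂ * sq p₁₄ * sq p₂₃ * sq p₂₄ * sq p₃₄
    + 2 * lcm a₂ a₃ * sq p₁₂ * sq p₁₃ * sq p₁₄ * sq p₂₄ * sq p₃₄

  threshold≡ : threshold ≡ b₃ + 2 * (M₁₃ + M₂₃) + M₁₂ + a₄ * A₄
  threshold≡ = regroup a₃ a₄ (lcm a₁ a₂) (lcm a₁ a₃) (lcm a₂ a₃)
    (sq p₁₂) (sq p₁₃) (sq p₁₄) (sq p₂₃) (sq p₂₄) (sq p₃₄)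
    where
    regroup : ∀ a₃ a₄ L₁₂ L₁₃ L₂₃ q₁₂ q₁₃ q₁₄ q₂₃ q₂₄ q₃₄ →
      a₃ * q₁₂ * q₁₄ * q₂₄ + a₄ * q₁₂ * q₁₃ * q₂₃ + L₁₂ * q₁₃ * q₁₄ * q₂₃ * q₂₄ * q₃₄
        + 2 * L₁₃ * q₁₂ * q₁₄ * q₂₃ * q₂₄ * q₃₄ + 2 * L₂₃ * q₁₂ * q₁₃ * q₁₄ * q₂₄ * q₃₄
      ≡ a₃ * (q₁₂ * q₁₄ * q₂₄)
        + 2 * (L₁₃ * (q₂₃ * q₂₄ * q₃₄ * (q₁₂ * q₁₄)) + L₂₃ * (q₁₃ * q₁₄ * q₃₄ * (q₁₂ * q₂₄)))
        + L₁₂ * (q₂₃ * q₂₄ * q₃₄ * (q₁₃ * q₁₄)) + a₄ * (q₁₂ * q₁₃ * q₂₃)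
    regroup = solve-∀

  representation : ∀ {n} → threshold ≤ n → Representation p₁₂ p₁₃ p₂₃ b₁ b₂ b₃ (n ∸ a₄ * A₄)
  representation {n} n≥ = three-term-representation coprime E₁₂ E₁₃ E₂₃
    (∣n⇒∣m*n (a₃ / gcd a₁ a₃) (∣m⇒∣m*n (sq p₁₄) ∣-refl))
    (∣n⇒∣m*n (a₃ / gcd a₂ a₃) (∣m⇒∣m*n (sq p₂₄) ∣-refl))
    (∣n⇒∣m*n (a₂ / gcd a₂ a₃) (∣m⇒∣m*n (sq p₃₄) ∣-refl))
    (m+n≤o⇒m≤o∸n (b₃ + 2 * (M₁₃ + M₂₃) + M₁₂) (subst (_≤ n) threshold≡ n≥))

  no-common-prime-square : ∀ {π X₁ X₂ X₃} → Prime π →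
    ¬ (p₁₂ * p₁₂ ∣ X₁ × p₁₂ * p₁₂ ∣ X₂) → ¬ (p₁₃ * p₁₃ ∣ X₁ × p₁₃ * p₁₃ ∣ X₃) → ¬ (p₂₃ * p₂₃ ∣ X₂ × p₂₃ * p₂₃ ∣ X₃) →
    π * π ∣ A₁ * X₁ → π * π ∣ A₂ * X₂ → π * π ∣ A₃ * X₃ → π * π ∣ A₄ → ⊥
  no-common-prime-square {π} P ¬p₁₂²∣X₁∧X₂ ¬p₁₃²∣X₁∧X₃ ¬p₂₃²∣X₂∧X₃ π²∣A₁X₁ π²∣A₂X₂ π²∣A₃X₃ π²∣A₄
    with π ≟ p₁₂ | π ≟ p₁₃ | π ≟ p₂₃
  ... | yes refl | _ | _ = ¬p₁₂²∣X₁∧X₂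
    ( prime²∣m*n∧∤m⇒prime²∣n P (∤A₁ P p₁₂≢p₂₃ p₁₂≢p₂₄ p₁₂≢p₃₄) π²∣A₁X₁
    , prime²∣m*n∧∤m⇒prime²∣n P (∤A₂ P p₁₂≢p₁₃ p₁₂≢p₁₄ p₁₂≢p₃₄) π²∣A₂X₂ )
  ... | no _ | yes refl | _ = ¬p₁₃²∣X₁∧X₃
    ( prime²∣m*n∧∤m⇒prime²∣n P (∤A₁ P p₁₃≢p₂₃ p₁₃≢p₂₄ p₁₃≢p₃₄) π²∣A₁X₁
    , prime²∣m*n∧∤m⇒prime²∣n P (∤A₃ P (≢-sym p₁₂≢p₁₃) p₁₃≢p₁₄ p₁₃≢p₂₄) π²∣A₃X₃ )
  ... | no _ | no _ | yes refl = ¬p₂₃²∣X₂∧X₃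
    ( prime²∣m*n∧∤m⇒prime²∣n P (∤A₂ P (≢-sym p₁₃≢p₂₃) (≢-sym p₁₄≢p₂₃) p₂₃≢p₃₄) π²∣A₂X₂
    , prime²∣m*n∧∤m⇒prime²∣n P (∤A₃ P (≢-sym p₁₂≢p₂₃) (≢-sym p₁₄≢p₂₃) p₂₃≢p₂₄) π²∣A₃X₃ )
  ... | no π≢p₁₂ | no π≢p₁₃ | no π≢p₂₃ = ∤A₄ P π≢p₁₂ π≢p₁₃ π≢p₂₃ (m*n∣⇒m∣ π π π²∣A₄)

  module Solution {n} (n≥ : threshold ≤ n) where
    open Representation (representation n≥)

    μ₁ μ₂ μ₃ μ₄ : ℕ
    μ₁ = A₁ * X₁
    μ₂ = A₂ * X₂
    μ₃ = A₃ * X₃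
    μ₄ = A₄

    0<μ₁ : 0 < μ₁
    0<μ₁ = *-mono-≤ (>-nonZero⁻¹ A₁) 1≤X₁
    0<μ₂ : 0 < μ₂
    0<μ₂ = *-mono-≤ (>-nonZero⁻¹ A₂) 1≤X₂
    0<μ₃ : 0 < μ₃
    0<μ₃ = *-mono-≤ (>-nonZero⁻¹ A₃) 1≤X₃
    0<μ₄ : 0 < μ₄
    0<μ₄ = >-nonZero⁻¹ A₄

    n≡ : n ≡ a₁ * μ₁ + a₂ * μ₂ + a₃ * μ₃ + a₄ * μ₄
    n≡ = begin
      n                                      ≡⟨ m∸n+n≡m (m+n≤o⇒n≤o (b₃ + 2 * (M₁₃ + M₂₃) + M₁₂) (subst (_≤ n) threshold≡ n≥)) ⟨
      n ∸ a₄ * A₄ + a₄ * A₄                  ≡⟨ cong (_+ a₄ * A₄) m≡ ⟩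
      b₁ * X₁ + b₂ * X₂ + b₃ * X₃ + a₄ * A₄  ≡⟨ regroup a₁ A₁ X₁ a₂ A₂ X₂ a₃ A₃ X₃ (a₄ * A₄) ⟩
      a₁ * μ₁ + a₂ * μ₂ + a₃ * μ₃ + a₄ * μ₄  ∎
      where
      open ≡-Reasoning
      regroup : ∀ a₁ A₁ X₁ a₂ A₂ X₂ a₃ A₃ X₃ z →
        a₁ * A₁ * X₁ + a₂ * A₂ * X₂ + a₃ * A₃ * X₃ + z ≡ a₁ * (A₁ * X₁) + a₂ * (A₂ * X₂) + a₃ * (A₃ * X₃) + z
      regroup = solve-∀

    squarefree : SquareFree (gcd4 μ₁ μ₂ μ₃ μ₄)
    squarefree = no-prime-square⇒squarefree {{gcd4≢0}} λ P π²∣g →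
      no-common-prime-square P ¬p²∣X₁∧X₂ ¬q²∣X₁∧X₃ ¬r²∣X₂∧X₃
        (∣-trans π²∣g (divides-μ zero)) (∣-trans π²∣g (divides-μ (suc zero)))
        (∣-trans π²∣g (divides-μ (suc (suc zero)))) (∣-trans π²∣g (divides-μ (suc (suc (suc zero)))))
      where
      divides-μ = gcd4∣idx4 μ₁ μ₂ μ₃ μ₄
      gcd4≢0 : NonZero (gcd4 μ₁ μ₂ μ₃ μ₄)
      gcd4≢0 = ≢-nonZero (gcd[m,n]≢0 (gcd3 μ₁ μ₂ μ₃) μ₄ (inj₂ (≢-nonZero⁻¹ A₄)))

    p₂₃²∣μ₁ : p₂₃ * p₂₃ ∣ μ₁
    p₂₃²∣μ₁ = ∣m⇒∣m*n X₁ (∣m⇒∣m*n (sq p₃₄) (m∣m*n (sq p₂₄)))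
    p₂₄²∣μ₁ : p₂₄ * p₂₄ ∣ μ₁
    p₂₄²∣μ₁ = ∣m⇒∣m*n X₁ (n∣m*n*o (sq p₂₃) (sq p₃₄))
    p₃₄²∣μ₁ : p₃₄ * p₃₄ ∣ μ₁
    p₃₄²∣μ₁ = ∣m⇒∣m*n X₁ (n∣m*n (sq p₂₃ * sq p₂₄))
    p₁₃²∣μ₂ : p₁₃ * p₁₃ ∣ μ₂
    p₁₃²∣μ₂ = ∣m⇒∣m*n X₂ (∣m⇒∣m*n (sq p₃₄) (m∣m*n (sq p₁₄)))
    p₁₄²∣μ₂ : p₁₄ * p₁₄ ∣ μ₂
    p₁₄²∣μ₂ = ∣m⇒∣m*n X₂ (n∣m*n*o (sq p₁₃) (sq p₃₄))
    p₃₄²∣μ₂ : p₃₄ * p₃₄ ∣ μ₂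
    p₃₄²∣μ₂ = ∣m⇒∣m*n X₂ (n∣m*n (sq p₁₃ * sq p₁₄))
    p₁₂²∣μ₃ : p₁₂ * p₁₂ ∣ μ₃
    p₁₂²∣μ₃ = ∣m⇒∣m*n X₃ (∣m⇒∣m*n (sq p₂₄) (m∣m*n (sq p₁₄)))
    p₁₄²∣μ₃ : p₁₄ * p₁₄ ∣ μ₃
    p₁₄²∣μ₃ = ∣m⇒∣m*n X₃ (n∣m*n*o (sq p₁₂) (sq p₂₄))
    p₂₄²∣μ₃ : p₂₄ * p₂₄ ∣ μ₃
    p₂₄²∣μ₃ = ∣m⇒∣m*n X₃ (n∣m*n (sq p₁₂ * sq p₁₄))
    p₁₂²∣μ₄ : p₁₂ * p₁₂ ∣ μ₄
    p₁₂²∣μ₄ = ∣m⇒∣m*n (sq p₂₃) (m∣m*n (sq p₁₃))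
    p₁₃²∣μ₄ : p₁₃ * p₁₃ ∣ μ₄
    p₁₃²∣μ₄ = n∣m*n*o (sq p₁₂) (sq p₂₃)
    p₂₃²∣μ₄ : p₂₃ * p₂₃ ∣ μ₄
    p₂₃²∣μ₄ = n∣m*n (sq p₁₂ * sq p₁₃)

    not-squarefree : ∀ i j → ¬ SquareFree (gcd (idx4 μ₁ μ₂ μ₃ μ₄ i) (idx4 μ₁ μ₂ μ₃ μ₄ j))
    not-squarefree zero zero = prime²∣m∧n⇒¬squarefree-gcd P₂₃ p₂₃²∣μ₁ p₂₃²∣μ₁
    not-squarefree zero (suc zero) = prime²∣m∧n⇒¬squarefree-gcd P₃₄ p₃₄²∣μ₁ p₃₄²∣μ₂
    not-squarefree zero (suc (suc zero)) = prime²∣m∧n⇒¬squarefree-gcd P₂₄ p₂₄²∣μ₁ p₂₄²∣μ₃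
    not-squarefree zero (suc (suc (suc zero))) = prime²∣m∧n⇒¬squarefree-gcd P₂₃ p₂₃²∣μ₁ p₂₃²∣μ₄
    not-squarefree (suc zero) zero = prime²∣m∧n⇒¬squarefree-gcd P₃₄ p₃₄²∣μ₂ p₃₄²∣μ₁
    not-squarefree (suc zero) (suc zero) = prime²∣m∧n⇒¬squarefree-gcd P₁₃ p₁₃²∣μ₂ p₁₃²∣μ₂
    not-squarefree (suc zero) (suc (suc zero)) = prime²∣m∧n⇒¬squarefree-gcd P₁₄ p₁₄²∣μ₂ p₁₄²∣μ₃
    not-squarefree (suc zero) (suc (suc (suc zero))) = prime²∣m∧n⇒¬squarefree-gcd P₁₃ p₁₃²∣μ₂ p₁₃²∣μ₄
    not-squarefree (suc (suc zero)) zero = prime²∣m∧n⇒¬squarefree-gcd P₂₄ p₂₄²∣μ₃ p₂₄²∣μ₁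
    not-squarefree (suc (suc zero)) (suc zero) = prime²∣m∧n⇒¬squarefree-gcd P₁₄ p₁₄²∣μ₃ p₁₄²∣μ₂
    not-squarefree (suc (suc zero)) (suc (suc zero)) = prime²∣m∧n⇒¬squarefree-gcd P₁₂ p₁₂²∣μ₃ p₁₂²∣μ₃
    not-squarefree (suc (suc zero)) (suc (suc (suc zero))) = prime²∣m∧n⇒¬squarefree-gcd P₁₂ p₁₂²∣μ₃ p₁₂²∣μ₄
    not-squarefree (suc (suc (suc zero))) zero = prime²∣m∧n⇒¬squarefree-gcd P₂₃ p₂₃²∣μ₄ p₂₃²∣μ₁
    not-squarefree (suc (suc (suc zero))) (suc zero) = prime²∣m∧n⇒¬squarefree-gcd P₁₃ p₁₃²∣μ₄ p₁₃²∣μ₂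
    not-squarefree (suc (suc (suc zero))) (suc (suc zero)) = prime²∣m∧n⇒¬squarefree-gcd P₁₂ p₁₂²∣μ₄ p₁₂²∣μ₃
    not-squarefree (suc (suc (suc zero))) (suc (suc (suc zero))) = prime²∣m∧n⇒¬squarefree-gcd P₁₂ p₁₂²∣μ₄ p₁₂²∣μ₄


mainTheorem4 : (a₁ a₂ a₃ a₄ : ℕ) → 0 < a₁ → 0 < a₂ → 0 < a₃ → 0 < a₄ →
  gcd3 a₁ a₂ a₃ ≡ 1 →
  (p₁₂ p₁₃ p₁₄ p₂₃ p₂₄ p₃₄ : ℕ) →
  Prime p₁₂ → Prime p₁₃ → Prime p₁₄ → Prime p₂₃ → Prime p₂₄ → Prime p₃₄ →
  p₁₂ ≢ p₁₃ → p₁₂ ≢ p₁₄ → p₁₂ ≢ p₂₃ → p₁₂ ≢ p₂₄ → p₁₂ ≢ p₃₄ →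
  p₁₃ ≢ p₁₄ → p₁₃ ≢ p₂₃ → p₁₃ ≢ p₂₄ → p₁₃ ≢ p₃₄ →
  p₁₄ ≢ p₂₃ → p₁₄ ≢ p₂₄ → p₁₄ ≢ p₃₄ →
  p₂₃ ≢ p₂₄ → p₂₃ ≢ p₃₄ →
  p₂₄ ≢ p₃₄ →
  ¬ (p₁₄ ∣ a₁) → ¬ (p₂₄ ∣ a₂) → ¬ (p₃₄ ∣ a₃) →
  ¬ (p₁₂ ∣ gcd a₁ a₂) → ¬ (p₁₃ ∣ gcd a₁ a₃) → ¬ (p₂₃ ∣ gcd a₂ a₃) →
  (n : ℕ) → 0 < n →
  a₃ * sq p₁₂ * sq p₁₄ * sq p₂₄
    + a₄ * sq p₁₂ * sq p₁₃ * sq p₂₃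
    + lcm a₁ a₂ * sq p₁₃ * sq p₁₄ * sq p₂₃ * sq p₂₄ * sq p₃₄
    + 2 * lcm a₁ a₃ * sq p₁₂ * sq p₁₄ * sq p₂₃ * sq p₂₄ * sq p₃₄
    + 2 * lcm a₂ a₃ * sq p₁₂ * sq p₁₃ * sq p₁₄ * sq p₂₄ * sq p₃₄
    ≤ n →
  ∃ λ μ₁ → ∃ λ μ₂ → ∃ λ μ₃ → ∃ λ μ₄ →
    0 < μ₁ × 0 < μ₂ × 0 < μ₃ × 0 < μ₄ ×
    n ≡ a₁ * μ₁ + a₂ * μ₂ + a₃ * μ₃ + a₄ * μ₄ ×
    SquareFree (gcd4 μ₁ μ₂ μ₃ μ₄) ×
    ((i j : Fin 4) → ¬ SquareFree (gcd (idx4 μ₁ μ₂ μ₃ μ₄ i) (idx4 μ₁ μ₂ μ₃ μ₄ j)))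
mainTheorem4 a₁ a₂ a₃ a₄ 0<a₁ 0<a₂ 0<a₃ _ gcd₃≡1 p₁₂ p₁₃ p₁₄ p₂₃ p₂₄ p₃₄ P₁₂ P₁₃ P₁₄ P₂₃ P₂₄ P₃₄
  p₁₂≢p₁₃ p₁₂≢p₁₄ p₁₂≢p₂₃ p₁₂≢p₂₄ p₁₂≢p₃₄ p₁₃≢p₁₄ p₁₃≢p₂₃ p₁₃≢p₂₄ p₁₃≢p₃₄ p₁₄≢p₂₃ p₁₄≢p₂₄ p₁₄≢p₃₄
  p₂₃≢p₂₄ p₂₃≢p₃₄ p₂₄≢p₃₄ p₁₄∤a₁ p₂₄∤a₂ p₃₄∤a₃ p₁₂∤gcd p₁₃∤gcd p₂₃∤gcd n _ n≥ =
  μ₁ , μ₂ , μ₃ , μ₄ , 0<μ₁ , 0<μ₂ , 0<μ₃ , 0<μ₄ , n≡ , squarefree , not-squarefree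
  where
  open Construction a₁ a₂ a₃ a₄ 0<a₁ 0<a₂ 0<a₃ gcd₃≡1 p₁₂ p₁₃ p₁₄ p₂₃ p₂₄ p₃₄ P₁₂ P₁₃ P₁₄ P₂₃ P₂₄ P₃₄
    p₁₂≢p₁₃ p₁₂≢p₁₄ p₁₂≢p₂₃ p₁₂≢p₂₄ p₁₂≢p₃₄ p₁₃≢p₁₄ p₁₃≢p₂₃ p₁₃≢p₂₄ p₁₃≢p₃₄ p₁₄≢p₂₃ p₁₄≢p₂₄ p₁₄≢p₃₄
    p₂₃≢p₂₄ p₂₃≢p₃₄ p₂₄≢p₃₄ p₁₄∤a₁ p₂₄∤a₂ p₃₄∤a₃ p₁₂∤gcd p₁₃∤gcd p₂₃∤gcd
  open Solution n≥
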